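{- Let $h>k$ be relatively prime squarefree positive integers, $m=hk^2$, $\widehat m=h^2k$, $\alpha,\widehat\alpha$ the real cube roots of $m,\widehat m$, $K=\mathbb{Q}(\alpha)$, and $\sigma=3$ if $m\equiv\pm1\pmod 9$, $\sigma=1$ otherwise. Let $I$ be a primitive ideal of $\mathcal{O}_K$ of length $L$. If $L\le\min\{\alpha,\frac{\widehat\alpha}{\sigma}\}$, then $I$ is reduced.
   Context: $\mathcal{O}_K=\mathbb{Z}\oplus\alpha\mathbb{Z}\oplus\theta\mathbb{Z}$ with $\theta=\frac1\sigma(k\pm k\alpha+\widehat\alpha)$ (sign $-$ if $m\equiv-1\pmod9$, $+$ otherwise). Every nonzero ideal has a unique canonical form $a\mathbb{Z}+(b+c\alpha)\mathbb{Z}+(d+e\alpha+f\theta)\mathbb{Z}$ with integers $a,c,f>0$, $0\le b<a$, $0\le d<a$, $0\le e<c$; its length is $L=a$, the smallest positive rational integer in it, and it is primitive if $\gcd(a,b,c,d,e,f)=1$. The shadow $\mathrm{Sh}(\beta)$ is the product of the two conjugates of $\beta$ other than $\beta$ itself, and $|\beta|$ is the absolute value of the real number $\beta$. A primitive ideal $I$ of length $L$ is reduced if for all $\beta\in I$, $|\beta|<L$ and $|\mathrm{Sh}(\beta)|<L^2$ together imply $\beta=0$. -}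

module Defs where

open import Data.Nat as ℕ using (ℕ; zero; suc)
open import Data.Nat.DivMod using (_%_)
open import Data.Nat.Divisibility using (_∣_)
open import Data.Nat.Primality using (Prime)
open import Data.Integer as ℤ using (ℤ; +_)
open import Data.Rational as ℚ using (ℚ; 0ℚ; 1ℚ)
open import Data.Product using (Σ; ∃; _×_; _,_)
open import Relation.Binary.PropositionalEquality using (_≡_)
open import Relation.Nullary using (¬_)

SquareFree : ℕ → Set
SquareFree n = ∀ p → Prime p → ¬ (p ℕ.* p ∣ n)

mOf : ℕ → ℕ → ℕ
mOf h k = h ℕ.* (k ℕ.* k)

m̂Of : ℕ → ℕ → ℕ
m̂Of h k = (h ℕ.* h) ℕ.* k

σOf : ℕ → ℕ
σOf m with m % 9
... | 1 = 3
... | 8 = 3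
... | _ = 1

-- reciprocal of a positive natural (only ever applied to positive arguments)
recip : ℕ → ℚ
recip zero    = 0ℚ
recip (suc n) = + 1 ℚ./ suc n

ℤtoℚ : ℤ → ℚ
ℤtoℚ z = z ℚ./ 1

ℕtoℚ : ℕ → ℚ
ℕtoℚ n = + n ℚ./ 1

-- Elements of K, written p + q α + r α² with p q r ∈ ℚ

record K : Set where
  constructor ⟨_,_,_⟩
  field
    c₀ c₁ c₂ : ℚ
open K public

infixl 6 _+K_ _-K_
infixr 7 _·K_

_+K_ : K → K → K
⟨ p , q , r ⟩ +K ⟨ p' , q' , r' ⟩ = ⟨ p ℚ.+ p' , q ℚ.+ q' , r ℚ.+ r' ⟩

-K_ : K → K
-K ⟨ p , q , r ⟩ = ⟨ ℚ.- p , ℚ.- q , ℚ.- r ⟩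

_-K_ : K → K → K
x -K y = x +K (-K y)

_·K_ : ℚ → K → K
s ·K ⟨ p , q , r ⟩ = ⟨ s ℚ.* p , s ℚ.* q , s ℚ.* r ⟩

ℚtoK : ℚ → K
ℚtoK s = ⟨ s , 0ℚ , 0ℚ ⟩

0K : K
0K = ℚtoK 0ℚ

-- multiplication in K, using α³ = m  (m passed explicitly)
mulK : ℕ → K → K → K
mulK m ⟨ p , q , r ⟩ ⟨ p' , q' , r' ⟩ =
  ⟨ p ℚ.* p' ℚ.+ M ℚ.* (q ℚ.* r' ℚ.+ r ℚ.* q')
  , p ℚ.* q' ℚ.+ q ℚ.* p' ℚ.+ M ℚ.* (r ℚ.* r')
  , p ℚ.* r' ℚ.+ q ℚ.* q' ℚ.+ r ℚ.* p' ⟩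
  where M = ℕtoℚ m

normK : ℕ → K → ℚ
normK m ⟨ p , q , r ⟩ =
  p ℚ.* p ℚ.* p ℚ.+ M ℚ.* (q ℚ.* q ℚ.* q) ℚ.+ (M ℚ.* M) ℚ.* (r ℚ.* r ℚ.* r)
  ℚ.- ℕtoℚ 3 ℚ.* M ℚ.* (p ℚ.* q ℚ.* r)
  where M = ℕtoℚ m

-- Shadow Sh(β) = β' β'' (product of the two other conjugates), an element of K:
-- (p² − m q r) + (m r² − p q) α + (q² − p r) α²
shK : ℕ → K → K
shK m ⟨ p , q , r ⟩ =
  ⟨ p ℚ.* p ℚ.- M ℚ.* (q ℚ.* r)
  , M ℚ.* (r ℚ.* r) ℚ.- p ℚ.* q
  , q ℚ.* q ℚ.- p ℚ.* r ⟩
  where M = ℕtoℚ m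

-- The real ordering of K ⊂ ℝ (α the real cube root of m).
-- Since the two non-real conjugates of β are complex conjugate,
-- Sh(β) = |β'|² > 0 for β ≠ 0, so β > 0 (as a real number) iff N(β) > 0.

PosK : ℕ → K → Set
PosK m β = 0ℚ ℚ.< normK m β

_<[_]_ : K → ℕ → K → Set
x <[ m ] y = PosK m (y -K x)

_≤[_]_ : K → ℕ → K → Set
x ≤[ m ] y = 0ℚ ℚ.≤ normK m (y -K x)

AbsLt : ℕ → K → K → Set
AbsLt m β t = ((-K t) <[ m ] β) × (β <[ m ] t)

module Field (h k : ℕ) where
  m m̂ σ : ℕ
  m = mOf h k
  m̂ = m̂Of h k
  σ = σOf m

  _*'_ : K → K → K
  _*'_ = mulK m

  α : K
  α = ⟨ 0ℚ , 1ℚ , 0ℚ ⟩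

  -- α̂ = ∛(h² k) = α² / k
  α̂ : K
  α̂ = ⟨ 0ℚ , 0ℚ , recip k ⟩

  sgn : ℚ
  sgn with m % 9
  ... | 8 = ℚ.- 1ℚ
  ... | _ = 1ℚ

  θ : K
  θ = recip σ ·K (⟨ ℕtoℚ k , sgn ℚ.* ℕtoℚ k , 0ℚ ⟩ +K α̂)

  elt : ℤ → ℤ → ℤ → K
  elt x y z = (ℚtoK (ℤtoℚ x) +K (ℤtoℚ y ·K α)) +K (ℤtoℚ z ·K θ)

  -- Canonical-form data (a, b, c, d, e, f) of the ℤ-lattice
  -- a ℤ + (b + c α) ℤ + (d + e α + f θ) ℤ
  record Form : Set where
    constructor form
    field
      a b c d e f : ℕ

  module _ (F : Form) where
    open Form F
    g₁ g₂ g₃ : K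
    g₁ = elt (+ a) (+ 0) (+ 0)
    g₂ = elt (+ b) (+ c) (+ 0)
    g₃ = elt (+ d) (+ e) (+ f)

    _∈L : K → Set
    β ∈L = ∃ λ u → ∃ λ v → ∃ λ w →
             β ≡ (ℤtoℚ u ·K g₁ +K ℤtoℚ v ·K g₂) +K ℤtoℚ w ·K g₃

    Canonical : Set
    Canonical = 0 ℕ.< a × 0 ℕ.< c × 0 ℕ.< f × b ℕ.< a × d ℕ.< a × e ℕ.< c

    -- the lattice is an ideal of O_K = ℤ ⊕ αℤ ⊕ θℤ: closed under ·α and ·θ
    IsIdeal : Set
    IsIdeal = (α *' g₁) ∈L × (α *' g₂) ∈L × (α *' g₃) ∈L
            × (θ *' g₁) ∈L × (θ *' g₂) ∈L × (θ *' g₃) ∈L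

    IsCanonicalIdeal : Set
    IsCanonicalIdeal = Canonical × IsIdeal

    Primitive : Set
    Primitive = ∀ g → g ∣ a → g ∣ b → g ∣ c → g ∣ d → g ∣ e → g ∣ f → g ≡ 1

    Len : ℕ
    Len = a

    Reduced : Set
    Reduced = ∀ β → β ∈L →
                AbsLt m β (ℚtoK (ℕtoℚ a)) →
                AbsLt m (shK m β) (ℚtoK (ℕtoℚ (a ℕ.* a))) →
                β ≡ 0K

{-# OPTIONS --safe #-}
module Submission where

-- An element of K = ℚ(α) ⊂ ℝ is positive iff its norm is.  Since m is not a
-- cube, the norm of p + q α + r α², as a cubic in p, has a single real root, so
-- it stays positive when p grows; with N(Sh ξ) = N(ξ)² and
-- (ξ + η) Sh η = ξ Sh η + N η this makes the elements of positive norm a cone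
-- closed under sums, products and positive rational multiples.
--
-- For β = p + q α + r α² with |β| < L and |Sh β| < L², Parseval's identity for
-- (β, β', β'') ↦ (p, q α, r α²) gives |p|, |q α|, |r α²| < L.  In the basis
-- a, b + c α, d + e α + f θ of I, write β = u a + v (b + c α) + w (d + e α + f θ).
-- Then r = w f / (σ k), so |r α²| = |w f| α̂ / σ ≥ |w| L forces w = 0; next
-- q = v c and |q α| ≥ |v| α ≥ |v| L force v = 0; finally |u a| < L = a gives u = 0.

open import Defs
open import Algebra.Properties.Group using (x∙y⁻¹≈ε⇒x≈y)
open import Data.Empty using (⊥-elim)
open import Data.Integer as ℤ using (ℤ; +_; -[1+_])
import Data.Integer.Properties as ℤₚ
open import Data.List using ([]; _∷_)
open import Data.List.Relation.Unary.All using (_∷_)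
import Data.Maybe as Maybe
open import Data.Nat as ℕ using (ℕ; suc)
open import Data.Nat.Coprimality as Coprimality using (Coprime)
open import Data.Nat.Divisibility using (_∣_; divides; ∣m⇒∣m*n; *-pres-∣; *-cancelˡ-∣; m*n∣⇒m∣; *-monoˡ-∣)
open import Data.Nat.ListAction using (product)
open import Data.Nat.Primality using (Prime; euclidsLemma; prime⇒nonZero; ¬prime[1])
open import Data.Nat.Primality.Factorisation using (factorise)
import Data.Nat.Properties as ℕₚ
import Data.Nat.Tactic.RingSolver as ℕ-Solver
open import Data.Product using (Σ-syntax; _×_; _,_; proj₁; proj₂)
open import Data.Rational as ℚ using (ℚ; mkℚ; 0ℚ; 1ℚ; _+_; _*_; _-_; -_; 1/_; _<_; _≤_; _<?_; _≤?_; _≟_)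
import Data.Rational.Properties as ℚₚ
import Data.Rational.Unnormalised as ℚᵘ
import Data.Rational.Unnormalised.Properties as ℚᵘₚ
open import Data.Sum using (_⊎_; inj₁; inj₂; [_,_]′)
open import Function using (id)
open import Level using (0ℓ)
open import Relation.Binary.Definitions using (tri<; tri≈; tri>)
open import Relation.Binary.PropositionalEquality
open import Relation.Nullary using (¬_; yes; no)
open import Relation.Nullary.Decidable using (dec⇒maybe; decidable-stable)
open import Tactic.RingSolver.Core.AlmostCommutativeRing using (AlmostCommutativeRing; fromCommutativeRing)

ℚ-ring : AlmostCommutativeRing 0ℓ 0ℓ
ℚ-ring = fromCommutativeRing ℚₚ.+-*-commutativeRing λ x → Maybe.map sym (dec⇒maybe (x ≟ 0ℚ))

open import Tactic.RingSolver using (solve-∀)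
open import Tactic.RingSolver.NonReflective ℚ-ring using (solve; _⊜_; Expr; Κ; _⊕_; _⊗_; ⊝_)

-- The reflective solver does not unfold defined operations such as those of
-- Defs, so identities about them are proved by the non-reflective solver on
-- these syntactic copies, whose denotations unfold to the very same terms.
module Syntax {n : ℕ} where
  E KE : Set
  E  = Expr ℚ n
  KE = E × E × E

  infixl 6 _⊖_ _⊕K_ _⊖K_
  infixr 7 _⊙K_
  infix 8 ⊝K_

  _⊖_ : E → E → E
  x ⊖ y = x ⊕ ⊝ y

  π₀ π₁ π₂ : KE → E
  π₀ (p , _ , _) = p
  π₁ (_ , q , _) = q
  π₂ (_ , _ , r) = r

  ⟪_⟫ : E → KE
  ⟪ s ⟫ = s , Κ 0ℚ , Κ 0ℚ

  oneE αE α²E : KE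
  oneE = Κ 1ℚ , Κ 0ℚ , Κ 0ℚ
  αE   = Κ 0ℚ , Κ 1ℚ , Κ 0ℚ
  α²E  = Κ 0ℚ , Κ 0ℚ , Κ 1ℚ

  ⊝K_ : KE → KE
  ⊝K (p , q , r) = ⊝ p , ⊝ q , ⊝ r

  _⊕K_ _⊖K_ : KE → KE → KE
  (p , q , r) ⊕K (s , t , u) = p ⊕ s , q ⊕ t , r ⊕ u
  x ⊖K y = x ⊕K ⊝K y

  _⊙K_ : E → KE → KE
  c ⊙K (p , q , r) = c ⊗ p , c ⊗ q , c ⊗ r

  mulE : E → KE → KE → KE
  mulE M (p , q , r) (s , t , u) =
    p ⊗ s ⊕ M ⊗ (q ⊗ u ⊕ r ⊗ t) , p ⊗ t ⊕ q ⊗ s ⊕ M ⊗ (r ⊗ u) , p ⊗ u ⊕ q ⊗ t ⊕ r ⊗ s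

  normE : E → KE → E
  normE M (p , q , r) =
    p ⊗ p ⊗ p ⊕ M ⊗ (q ⊗ q ⊗ q) ⊕ (M ⊗ M) ⊗ (r ⊗ r ⊗ r) ⊖ Κ (ℕtoℚ 3) ⊗ M ⊗ (p ⊗ q ⊗ r)

  shE : E → KE → KE
  shE M (p , q , r) = p ⊗ p ⊖ M ⊗ (q ⊗ r) , M ⊗ (r ⊗ r) ⊖ p ⊗ q , q ⊗ q ⊖ p ⊗ r

  cubicE : E → E → E → E
  cubicE Q C t = t ⊗ t ⊗ t ⊖ Κ (ℕtoℚ 3) ⊗ Q ⊗ t ⊕ C

  gapE : E → E → KE → KE
  gapE M L (p , q , r) = L ⊗ L ⊖ p ⊗ p , ⊝ (M ⊗ (r ⊗ r)) , ⊝ (q ⊗ q)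

  eltE : KE → E → E → E → KE
  eltE θ x y z = (⟪ x ⟫ ⊕K y ⊙K αE) ⊕K z ⊙K θ

  latticeE : KE → E → E → E → E → E → E → E → E → E → KE
  latticeE θ u v w a b c d e f =
    (u ⊙K eltE θ a (Κ 0ℚ) (Κ 0ℚ) ⊕K v ⊙K eltE θ b c (Κ 0ℚ)) ⊕K w ⊙K eltE θ d e f

open Syntax

private variable a b c : ℚ

<⇒≱ : a < b → ¬ b ≤ a
<⇒≱ a<b b≤a = ℚₚ.<-irrefl refl (ℚₚ.<-≤-trans a<b b≤a)

pos+pos : 0ℚ < a → 0ℚ < b → 0ℚ < a + b
pos+pos = ℚₚ.+-mono-<

pos+nonNeg : 0ℚ < a → 0ℚ ≤ b → 0ℚ < a + b
pos+nonNeg = ℚₚ.+-mono-<-≤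

nonNeg+nonNeg : 0ℚ ≤ a → 0ℚ ≤ b → 0ℚ ≤ a + b
nonNeg+nonNeg = ℚₚ.+-mono-≤

pos*pos : 0ℚ < a → 0ℚ < b → 0ℚ < a * b
pos*pos {a} {b} a>0 b>0 =
  ℚₚ.positive⁻¹ _ {{ℚₚ.pos*pos⇒pos a {{ℚ.positive a>0}} b {{ℚ.positive b>0}}}}

nonNeg*nonNeg : 0ℚ ≤ a → 0ℚ ≤ b → 0ℚ ≤ a * b
nonNeg*nonNeg {a} {b} a≥0 b≥0 =
  ℚₚ.nonNegative⁻¹ _ {{ℚₚ.nonNeg*nonNeg⇒nonNeg a {{ℚ.nonNegative a≥0}} b {{ℚ.nonNegative b≥0}}}}

cube-nonNeg : 0ℚ ≤ a → 0ℚ ≤ a * a * a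
cube-nonNeg a≥0 = nonNeg*nonNeg (nonNeg*nonNeg a≥0 a≥0) a≥0

nonPos⇒neg-nonNeg : a ≤ 0ℚ → 0ℚ ≤ - a
nonPos⇒neg-nonNeg = ℚₚ.neg-antimono-≤

pos⇒¬neg-nonNeg : 0ℚ < a → ¬ 0ℚ ≤ - a
pos⇒¬neg-nonNeg {a} a>0 -a≥0 = ℚₚ.<-irrefl refl (subst (0ℚ <_) (ℚₚ.+-inverseʳ a) (pos+nonNeg a>0 -a≥0))

≤⇒nonNeg-diff : a ≤ b → 0ℚ ≤ b - a
≤⇒nonNeg-diff {a} {b} a≤b = subst (_≤ b - a) (ℚₚ.+-inverseʳ a) (ℚₚ.+-monoˡ-≤ (- a) a≤b)

two>0 : 0ℚ < ℕtoℚ 2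
two>0 = ℚₚ.positive⁻¹ (ℕtoℚ 2)

three>0 : 0ℚ < ℕtoℚ 3
three>0 = ℚₚ.positive⁻¹ (ℕtoℚ 3)

four>0 : 0ℚ < ℕtoℚ 4
four>0 = ℚₚ.positive⁻¹ (ℕtoℚ 4)

ℕtoℚ-nonNeg : ∀ n → 0ℚ ≤ ℕtoℚ n
ℕtoℚ-nonNeg n = ℚₚ.nonNegative⁻¹ _ {{ℚₚ.normalize-nonNeg n 1}}

ℕtoℚ-pos : ∀ n → .{{ℕ.NonZero n}} → 0ℚ < ℕtoℚ n
ℕtoℚ-pos n = ℚₚ.positive⁻¹ _ {{ℚₚ.normalize-pos n 1}}

recip-nonNeg : ∀ n → 0ℚ ≤ recip n
recip-nonNeg ℕ.zero  = ℚₚ.≤-refl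
recip-nonNeg (suc n) = ℚₚ.nonNegative⁻¹ _ {{ℚₚ.normalize-nonNeg 1 (suc n)}}

pos*-cancelʳ : 0ℚ < a * b → 0ℚ < b → 0ℚ < a
pos*-cancelʳ {a} {b} ab>0 b>0 with 0ℚ <? a
... | yes a>0 = a>0
... | no  a≯0 = ⊥-elim (<⇒≱ (subst (0ℚ <_) (ℚₚ.*-zeroˡ b) (ℚₚ.<-≤-trans ab>0 ab≤0b)) ℚₚ.≤-refl)
  where
  ab≤0b : a * b ≤ 0ℚ * b
  ab≤0b = ℚₚ.*-monoʳ-≤-nonNeg b {{ℚ.nonNegative (ℚₚ.<⇒≤ b>0)}} (ℚₚ.≮⇒≥ a≯0)

pos-product∧pos-sum⇒pos : 0ℚ < a * b → 0ℚ < a + b → 0ℚ < a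
pos-product∧pos-sum⇒pos {a} {b} ab>0 a+b>0 with 0ℚ <? a
... | yes a>0 = a>0
... | no  a≯0 = pos*-cancelʳ ab>0 (subst (0ℚ <_) (a+b-a a b) (pos+nonNeg a+b>0 (nonPos⇒neg-nonNeg (ℚₚ.≮⇒≥ a≯0))))
  where
  a+b-a : ∀ a b → a + b + - a ≡ b
  a+b-a = solve-∀ ℚ-ring

neg*neg : ∀ a → - a * - a ≡ a * a
neg*neg = solve-∀ ℚ-ring

square-nonNeg : ∀ a → 0ℚ ≤ a * a
square-nonNeg a with ℚₚ.≤-total 0ℚ a
... | inj₁ a≥0 = nonNeg*nonNeg a≥0 a≥0
... | inj₂ a≤0 = subst (0ℚ ≤_) (neg*neg a) (nonNeg*nonNeg (nonPos⇒neg-nonNeg a≤0) (nonPos⇒neg-nonNeg a≤0))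

square-pos : a ≢ 0ℚ → 0ℚ < a * a
square-pos {a} a≢0 with ℚₚ.<-cmp 0ℚ a
... | tri< a>0 _ _ = pos*pos a>0 a>0
... | tri≈ _ 0≡a _ = ⊥-elim (a≢0 (sym 0≡a))
... | tri> _ _ a<0 = subst (0ℚ <_) (neg*neg a) (pos*pos (ℚₚ.neg-antimono-< a<0) (ℚₚ.neg-antimono-< a<0))

cube-pos⇒pos : 0ℚ < a * a * a → 0ℚ < a
cube-pos⇒pos {a} a³>0 with a ≟ 0ℚ
... | yes refl = ⊥-elim (ℚₚ.<-irrefl refl a³>0)
... | no  a≢0 = pos*-cancelʳ (subst (0ℚ <_) (ℚₚ.*-comm (a * a) a) a³>0) (square-pos a≢0)

private
  difference-of-squares : ∀ a b → a * a - b * b ≡ (a - b) * (a + b)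
  difference-of-squares = solve-∀ ℚ-ring

  difference+sum : ∀ a b → (a - b) + (a + b) ≡ a * ℕtoℚ 2
  difference+sum = solve-∀ ℚ-ring

square-gap⇒pos : 0ℚ < a - b → 0ℚ < a * a - b * b → 0ℚ < a
square-gap⇒pos {a} {b} a-b>0 a²-b²>0 = pos*-cancelʳ (subst (0ℚ <_) (difference+sum a b) (pos+pos a-b>0 a+b>0)) two>0
  where
  a+b>0 : 0ℚ < a + b
  a+b>0 = pos*-cancelʳ (subst (0ℚ <_) (trans (difference-of-squares a b) (ℚₚ.*-comm (a - b) (a + b))) a²-b²>0) a-b>0

square-gap⇒gap : 0ℚ < a → 0ℚ < a * a - b * b → 0ℚ < a - b
square-gap⇒gap {a} {b} a>0 a²-b²>0 = pos-product∧pos-sum⇒pos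
  (subst (0ℚ <_) (difference-of-squares a b) a²-b²>0) (subst (0ℚ <_) (sym (difference+sum a b)) (pos*pos a>0 two>0))

*-square≥1 : ∀ a b → 0ℚ ≤ a * a - 1ℚ → 0ℚ ≤ b * b - 1ℚ → 0ℚ ≤ (a * b) * (a * b) - 1ℚ
*-square≥1 a b a²≥1 b²≥1 = subst (0ℚ ≤_) (identity a b) (nonNeg+nonNeg (nonNeg*nonNeg a²≥1 (square-nonNeg b)) b²≥1)
  where
  identity : ∀ a b → (a * a - 1ℚ) * (b * b) + (b * b - 1ℚ) ≡ (a * b) * (a * b) - 1ℚ
  identity = solve-∀ ℚ-ring

cube-square≥1 : ∀ a → 0ℚ ≤ a * a - 1ℚ → 0ℚ ≤ (a * a * a) * (a * a * a) - 1ℚ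
cube-square≥1 a a²≥1 = *-square≥1 (a * a) a (*-square≥1 a a a²≥1 a²≥1) a²≥1

¬scaled-square<square : ∀ x y t → 0ℚ ≤ y → 0ℚ ≤ x - y → 0ℚ ≤ t * t - 1ℚ → ¬ 0ℚ < y * y - (x * t) * (x * t)
¬scaled-square<square x y t y≥0 x-y≥0 t²≥1 gap>0 = pos⇒¬neg-nonNeg gap>0 (subst (0ℚ ≤_) (identity x y t)
  (nonNeg+nonNeg (nonNeg*nonNeg (square-nonNeg x) t²≥1)
                 (nonNeg*nonNeg x-y≥0 (nonNeg+nonNeg x-y≥0 (nonNeg*nonNeg (ℚₚ.<⇒≤ two>0) y≥0)))))
  where
  identity : ∀ x y t → x * x * (t * t - 1ℚ) + (x - y) * ((x - y) + ℕtoℚ 2 * y) ≡ - (y * y - (x * t) * (x * t))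
  identity = solve-∀ ℚ-ring

ℤtoℚ≡mkℚ : ∀ z → ℤtoℚ z ≡ mkℚ z 0 (Coprimality.sym (Coprimality.1-coprimeTo ℤ.∣ z ∣))
ℤtoℚ≡mkℚ (+ n)    = ℚₚ.normalize-coprime (Coprimality.sym (Coprimality.1-coprimeTo n))
ℤtoℚ≡mkℚ -[1+ n ] = cong -_ (ℚₚ.normalize-coprime (Coprimality.sym (Coprimality.1-coprimeTo (suc n))))

ℤtoℚ-* : ∀ x y → ℤtoℚ x * ℤtoℚ y ≡ ℤtoℚ (x ℤ.* y)
ℤtoℚ-* x y rewrite ℤtoℚ≡mkℚ x | ℤtoℚ≡mkℚ y = refl

ℕtoℚ-* : ∀ x y → ℕtoℚ (x ℕ.* y) ≡ ℕtoℚ x * ℕtoℚ y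
ℕtoℚ-* x y = trans (cong ℤtoℚ (ℤₚ.pos-* x y)) (sym (ℤtoℚ-* (+ x) (+ y)))

ℤtoℚ-mono-≤ : ∀ {x y} → x ℤ.≤ y → ℤtoℚ x ≤ ℤtoℚ y
ℤtoℚ-mono-≤ {x} {y} x≤y rewrite ℤtoℚ≡mkℚ x | ℤtoℚ≡mkℚ y =
  ℚ.*≤* (subst₂ ℤ._≤_ (sym (ℤₚ.*-identityʳ x)) (sym (ℤₚ.*-identityʳ y)) x≤y)

ℤtoℚ-square≥1 : ∀ {z} → z ≢ + 0 → 0ℚ ≤ ℤtoℚ z * ℤtoℚ z - 1ℚ
ℤtoℚ-square≥1 {z} z≢0 = ≤⇒nonNeg-diff (subst (1ℚ ≤_) (sym (ℤtoℚ-* z z)) (ℤtoℚ-mono-≤ (square≥1 z z≢0)))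
  where
  square≥1 : ∀ z → z ≢ + 0 → + 1 ℤ.≤ z ℤ.* z
  square≥1 (+ 0)      z≢0 = ⊥-elim (z≢0 refl)
  square≥1 ℤ.+[1+ n ] _   = ℤ.+≤+ (ℕ.s≤s ℕ.z≤n)
  square≥1 -[1+ n ]   _   = ℤ.+≤+ (ℕ.s≤s ℕ.z≤n)

ℕtoℚ-square≥1 : ∀ {n} → 0 ℕ.< n → 0ℚ ≤ ℕtoℚ n * ℕtoℚ n - 1ℚ
ℕtoℚ-square≥1 {suc n} _ = ℤtoℚ-square≥1 {+ suc n} λ ()

-- The depressed cubic t³ − 3 Q t + C

cubic : ℚ → ℚ → ℚ → ℚ
cubic Q C t = t * t * t - ℕtoℚ 3 * Q * t + C

cubic-increment : ∀ Q C x y → cubic Q C y ≡ cubic Q C x + (y - x) * (y * y + x * y + x * x - ℕtoℚ 3 * Q)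
cubic-increment = solve 4 (λ Q C x y →
  cubicE Q C y ⊜ (cubicE Q C x ⊕ (y ⊖ x) ⊗ (y ⊗ y ⊕ x ⊗ y ⊕ x ⊗ x ⊖ Κ (ℕtoℚ 3) ⊗ Q))) refl

-- Either the factor y² + x y + x² − 3 Q of the increment is nonnegative, or
-- x and y lie in the window t² < 4 Q, where C² > φ(t)² for
-- cubic Q C t = C − φ(t), so the cubic has the sign of C there.
cubic-mono : ∀ {Q C x y} → Q ≤ 0ℚ ⊎ 0ℚ < C * C - ℕtoℚ 4 * (Q * Q * Q) →
             0ℚ ≤ y - x → 0ℚ < cubic Q C x → 0ℚ < cubic Q C y
cubic-mono {Q} {C} {x} {y} disc y-x≥0 Fx>0 with 0ℚ ≤? y * y + x * y + x * x - ℕtoℚ 3 * Q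
... | yes D≥0 = subst (0ℚ <_) (sym (cubic-increment Q C x y)) (pos+nonNeg Fx>0 (nonNeg*nonNeg y-x≥0 D≥0))
... | no  D≱0 = subst (0ℚ <_) (sym (cubic≡C-φ Q C y)) (square-gap⇒gap C>0 (φ²<C² y 4Q-y²>0))
  where
  φ : ℚ → ℚ
  φ t = t * (ℕtoℚ 3 * Q - t * t)

  cubic≡C-φ : ∀ Q C t → cubic Q C t ≡ C - t * (ℕtoℚ 3 * Q - t * t)
  cubic≡C-φ = solve 3 (λ Q C t → cubicE Q C t ⊜ (C ⊖ t ⊗ (Κ (ℕtoℚ 3) ⊗ Q ⊖ t ⊗ t))) refl

  -D>0 : 0ℚ < - (y * y + x * y + x * x - ℕtoℚ 3 * Q)
  -D>0 = ℚₚ.neg-antimono-< (ℚₚ.≰⇒> D≱0)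

  4Q-x²>0 : 0ℚ < ℕtoℚ 4 * Q - x * x
  4Q-x²>0 = pos*-cancelʳ (subst (0ℚ <_) (sym (identity Q x y))
    (pos+nonNeg (pos*pos four>0 -D>0) (square-nonNeg (x + ℕtoℚ 2 * y)))) three>0
    where
    identity : ∀ Q x y → (ℕtoℚ 4 * Q - x * x) * ℕtoℚ 3
                         ≡ ℕtoℚ 4 * - (y * y + x * y + x * x - ℕtoℚ 3 * Q) + (x + ℕtoℚ 2 * y) * (x + ℕtoℚ 2 * y)
    identity = solve-∀ ℚ-ring

  4Q-y²>0 : 0ℚ < ℕtoℚ 4 * Q - y * y
  4Q-y²>0 = pos*-cancelʳ (subst (0ℚ <_) (sym (identity Q x y))
    (pos+nonNeg (pos*pos four>0 -D>0) (square-nonNeg (y + ℕtoℚ 2 * x)))) three>0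
    where
    identity : ∀ Q x y → (ℕtoℚ 4 * Q - y * y) * ℕtoℚ 3
                         ≡ ℕtoℚ 4 * - (y * y + x * y + x * x - ℕtoℚ 3 * Q) + (y + ℕtoℚ 2 * x) * (y + ℕtoℚ 2 * x)
    identity = solve-∀ ℚ-ring

  Q>0 : 0ℚ < Q
  Q>0 = pos*-cancelʳ (subst (0ℚ <_) (sym (identity Q x)) (pos+nonNeg 4Q-x²>0 (square-nonNeg x))) four>0
    where
    identity : ∀ Q x → Q * ℕtoℚ 4 ≡ (ℕtoℚ 4 * Q - x * x) + x * x
    identity = solve-∀ ℚ-ring

  disc>0 : 0ℚ < C * C - ℕtoℚ 4 * (Q * Q * Q)
  disc>0 = [ (λ Q≤0 → ⊥-elim (<⇒≱ Q>0 Q≤0)) , id ]′ disc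

  φ²<C² : ∀ t → 0ℚ < ℕtoℚ 4 * Q - t * t → 0ℚ < C * C - φ t * φ t
  φ²<C² t 4Q-t²>0 = subst (0ℚ <_) (sym (identity Q C t))
    (pos+nonNeg disc>0 (nonNeg*nonNeg (square-nonNeg (t * t - Q)) (ℚₚ.<⇒≤ 4Q-t²>0)))
    where
    identity : ∀ Q C t → C * C - t * (ℕtoℚ 3 * Q - t * t) * (t * (ℕtoℚ 3 * Q - t * t))
                         ≡ C * C - ℕtoℚ 4 * (Q * Q * Q) + (t * t - Q) * (t * t - Q) * (ℕtoℚ 4 * Q - t * t)
    identity = solve-∀ ℚ-ring

  C>0 : 0ℚ < C
  C>0 = square-gap⇒pos (subst (0ℚ <_) (cubic≡C-φ Q C x) Fx>0) (φ²<C² x 4Q-x²>0)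

oneK αK α²K : K
oneK = ⟨ 1ℚ , 0ℚ , 0ℚ ⟩
αK   = ⟨ 0ℚ , 1ℚ , 0ℚ ⟩
α²K  = ⟨ 0ℚ , 0ℚ , 1ℚ ⟩

K-≡ : ∀ {x y} → c₀ x ≡ c₀ y → c₁ x ≡ c₁ y → c₂ x ≡ c₂ y → x ≡ y
K-≡ refl refl refl = refl

module NormIdentities (m : ℕ) where
  M : ℚ
  M = ℕtoℚ m

  normK-mulK : ∀ x y → normK m (mulK m x y) ≡ normK m x * normK m y
  normK-mulK ⟨ p , q , r ⟩ ⟨ s , t , u ⟩ = solve 7 (λ M p q r s t u →
    normE M (mulE M (p , q , r) (s , t , u)) ⊜ normE M (p , q , r) ⊗ normE M (s , t , u)) refl M p q r s t u

  normK-shK : ∀ x → normK m (shK m x) ≡ normK m x * normK m x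
  normK-shK ⟨ p , q , r ⟩ = solve 4 (λ M p q r →
    normE M (shE M (p , q , r)) ⊜ normE M (p , q , r) ⊗ normE M (p , q , r)) refl M p q r

  normK-·K : ∀ c x → normK m (c ·K x) ≡ c * c * c * normK m x
  normK-·K c ⟨ p , q , r ⟩ = solve 5 (λ M c p q r →
    normE M (c ⊙K (p , q , r)) ⊜ c ⊗ c ⊗ c ⊗ normE M (p , q , r)) refl M c p q r

  normK-+K-0·K : ∀ x y → normK m (x +K 0ℚ ·K y) ≡ normK m x
  normK-+K-0·K ⟨ p , q , r ⟩ ⟨ s , t , u ⟩ = solve 7 (λ M p q r s t u →
    normE M ((p , q , r) ⊕K Κ 0ℚ ⊙K (s , t , u)) ⊜ normE M (p , q , r)) refl M p q r s t u

  mulK-+K-shK : ∀ x y → mulK m (x +K y) (shK m y) ≡ mulK m x (shK m y) +K ℚtoK (normK m y)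
  mulK-+K-shK ⟨ p , q , r ⟩ ⟨ s , t , u ⟩ = K-≡
    (solve 7 (λ M p q r s t u → π₀ (lhs M (p , q , r) (s , t , u)) ⊜ π₀ (rhs M (p , q , r) (s , t , u))) refl M p q r s t u)
    (solve 7 (λ M p q r s t u → π₁ (lhs M (p , q , r) (s , t , u)) ⊜ π₁ (rhs M (p , q , r) (s , t , u))) refl M p q r s t u)
    (solve 7 (λ M p q r s t u → π₂ (lhs M (p , q , r) (s , t , u)) ⊜ π₂ (rhs M (p , q , r) (s , t , u))) refl M p q r s t u)
    where
    lhs rhs : ∀ {n} → Expr ℚ n → KE → KE → KE
    lhs M x y = mulE M (x ⊕K y) (shE M y)
    rhs M x y = mulE M x (shE M y) ⊕K ⟪ normE M y ⟫

  normK-as-cubic : ∀ p q r → normK m ⟨ p , q , r ⟩ ≡ cubic (M * q * r) (M * (q * q * q) + M * M * (r * r * r)) p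
  normK-as-cubic p q r = solve 4 (λ M p q r →
    normE M (p , q , r) ⊜ cubicE (M ⊗ q ⊗ r) (M ⊗ (q ⊗ q ⊗ q) ⊕ M ⊗ M ⊗ (r ⊗ r ⊗ r)) p) refl M p q r

  normK-+K-ℚtoK : ∀ p q r c →
    normK m (⟨ p , q , r ⟩ +K ℚtoK c) ≡ cubic (M * q * r) (M * (q * q * q) + M * M * (r * r * r)) (p + c)
  normK-+K-ℚtoK p q r c = solve 5 (λ M p q r c →
    normE M ((p , q , r) ⊕K ⟪ c ⟫) ⊜ cubicE (M ⊗ q ⊗ r) (M ⊗ (q ⊗ q ⊗ q) ⊕ M ⊗ M ⊗ (r ⊗ r ⊗ r)) (p ⊕ c)) refl M p q r c

  normK-oneK : normK m oneK ≡ 1ℚ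
  normK-oneK = solve 1 (λ M → normE M oneE ⊜ Κ 1ℚ) refl M

  normK-αK : normK m αK ≡ M
  normK-αK = solve 1 (λ M → normE M αE ⊜ M) refl M

  normK-α²K : normK m α²K ≡ M * M
  normK-α²K = solve 1 (λ M → normE M α²E ⊜ M ⊗ M) refl M

  normK-αK-ℚtoK : ∀ L → normK m (αK -K ℚtoK L) ≡ M - L * L * L
  normK-αK-ℚtoK L = solve 2 (λ M L → normE M (αE ⊖K ⟪ L ⟫) ⊜ (M ⊖ L ⊗ L ⊗ L)) refl M L

  normK-rα²-ℚtoK : ∀ r S → normK m (⟨ 0ℚ , 0ℚ , r ⟩ -K ℚtoK S) ≡ M * M * (r * r * r) - S * S * S
  normK-rα²-ℚtoK r S = solve 3 (λ M r S →
    normE M ((Κ 0ℚ , Κ 0ℚ , r) ⊖K ⟪ S ⟫) ⊜ (M ⊗ M ⊗ (r ⊗ r ⊗ r) ⊖ S ⊗ S ⊗ S)) refl M r S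

  -- gap L β = L² − p² − (q α)² − (r α²)² for β = p + q α + r α².  Parseval for
  -- (β, β', β'') ↦ (p, q α, r α²) reads β² + 2 Sh β = 3 (p² + (q α)² + (r α²)²).
  gap : ℚ → K → K
  gap L ⟨ p , q , r ⟩ = ⟨ L * L - p * p , - (M * (r * r)) , - (q * q) ⟩

  gap-identity : ∀ L β →
    mulK m (ℚtoK L -K β) (β -K (-K ℚtoK L)) +K ℕtoℚ 2 ·K (ℚtoK (L * L) -K shK m β) ≡ ℕtoℚ 3 ·K gap L β
  gap-identity L ⟨ p , q , r ⟩ = K-≡
    (solve 5 (λ M L p q r → π₀ (lhs M L (p , q , r)) ⊜ π₀ (rhs M L (p , q , r))) refl M L p q r)
    (solve 5 (λ M L p q r → π₁ (lhs M L (p , q , r)) ⊜ π₁ (rhs M L (p , q , r))) refl M L p q r)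
    (solve 5 (λ M L p q r → π₂ (lhs M L (p , q , r)) ⊜ π₂ (rhs M L (p , q , r))) refl M L p q r)
    where
    lhs rhs : ∀ {n} → Expr ℚ n → Expr ℚ n → KE → KE
    lhs M L β = mulE M (⟪ L ⟫ ⊖K β) (β ⊖K ⊝K ⟪ L ⟫) ⊕K Κ (ℕtoℚ 2) ⊙K (⟪ L ⊗ L ⟫ ⊖K shE M β)
    rhs M L β = Κ (ℕtoℚ 3) ⊙K gapE M L β

  normK-gap₀ : ∀ L p q r → normK m ((gap L ⟨ p , q , r ⟩ +K (q * q) ·K α²K) +K (M * (r * r)) ·K αK)
                           ≡ (L * L - p * p) * (L * L - p * p) * (L * L - p * p)
  normK-gap₀ L p q r = solve 5 (λ M L p q r →
    normE M ((gapE M L (p , q , r) ⊕K (q ⊗ q) ⊙K α²E) ⊕K (M ⊗ (r ⊗ r)) ⊙K αE)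
      ⊜ (L ⊗ L ⊖ p ⊗ p) ⊗ (L ⊗ L ⊖ p ⊗ p) ⊗ (L ⊗ L ⊖ p ⊗ p)) refl M L p q r

  normK-gap₁ : ∀ L p q r → normK m ((gap L ⟨ p , q , r ⟩ +K (p * p) ·K oneK) +K (M * (r * r)) ·K αK)
                           ≡ (L * L * L) * (L * L * L) - (M * (q * q * q)) * (M * (q * q * q))
  normK-gap₁ L p q r = solve 5 (λ M L p q r →
    normE M ((gapE M L (p , q , r) ⊕K (p ⊗ p) ⊙K oneE) ⊕K (M ⊗ (r ⊗ r)) ⊙K αE)
      ⊜ ((L ⊗ L ⊗ L) ⊗ (L ⊗ L ⊗ L) ⊖ (M ⊗ (q ⊗ q ⊗ q)) ⊗ (M ⊗ (q ⊗ q ⊗ q)))) refl M L p q r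

  normK-gap₂ : ∀ L p q r → normK m ((gap L ⟨ p , q , r ⟩ +K (p * p) ·K oneK) +K (q * q) ·K α²K)
                           ≡ (L * L * L) * (L * L * L) - (M * M * (r * r * r)) * (M * M * (r * r * r))
  normK-gap₂ L p q r = solve 5 (λ M L p q r →
    normE M ((gapE M L (p , q , r) ⊕K (p ⊗ p) ⊙K oneE) ⊕K (q ⊗ q) ⊙K α²E)
      ⊜ ((L ⊗ L ⊗ L) ⊗ (L ⊗ L ⊗ L) ⊖ (M ⊗ M ⊗ (r ⊗ r ⊗ r)) ⊗ (M ⊗ M ⊗ (r ⊗ r ⊗ r)))) refl M L p q r

-- The cone of elements of positive norm

module PositiveCone (m : ℕ) (m-not-cube : ∀ t → t * t * t ≢ ℕtoℚ m) where
  open NormIdentities m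
  private variable ξ η : K

  M>0 : 0ℚ < M
  M>0 = ℕtoℚ-pos m {{ℕ.≢-nonZero m≢0}}
    where
    m≢0 : m ≢ 0
    m≢0 refl = m-not-cube 0ℚ refl

  cube-ratio : ∀ {q r} → q * q * q ≡ M * (r * r * r) → r ≡ 0ℚ
  cube-ratio {q} {r} q³≡Mr³ with r ≟ 0ℚ
  ... | yes r≡0 = r≡0
  ... | no  r≢0 = ⊥-elim (m-not-cube (q * s) (begin
    (q * s) * (q * s) * (q * s)       ≡⟨ regroup₁ q s ⟩
    q * q * q * (s * s * s)           ≡⟨ cong (_* (s * s * s)) q³≡Mr³ ⟩
    M * (r * r * r) * (s * s * s)     ≡⟨ regroup₂ M r s ⟩
    M * ((r * s) * (r * s) * (r * s)) ≡⟨ cong (λ u → M * (u * u * u)) (ℚₚ.*-inverseʳ r) ⟩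
    M * 1ℚ                            ≡⟨ ℚₚ.*-identityʳ M ⟩
    M                                 ∎))
    where
    open ≡-Reasoning
    instance
      r-nonZero : ℚ.NonZero r
      r-nonZero = ℚ.≢-nonZero r≢0
    s : ℚ
    s = 1/ r
    regroup₁ : ∀ q s → (q * s) * (q * s) * (q * s) ≡ q * q * q * (s * s * s)
    regroup₁ = solve-∀ ℚ-ring
    regroup₂ : ∀ M r s → M * (r * r * r) * (s * s * s) ≡ M * ((r * s) * (r * s) * (r * s))
    regroup₂ = solve-∀ ℚ-ring

  -- The discriminant of the norm as a cubic in the rational coordinate is
  -- −27 m² (q³ − m r³)², which vanishes only for q = r = 0.
  single-real-root : ∀ q r → M * q * r ≤ 0ℚ
    ⊎ 0ℚ < (M * (q * q * q) + M * M * (r * r * r)) * (M * (q * q * q) + M * M * (r * r * r))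
           - ℕtoℚ 4 * ((M * q * r) * (M * q * r) * (M * q * r))
  single-real-root q r with q * q * q - M * (r * r * r) ≟ 0ℚ
  ... | yes d≡0 = inj₁ (ℚₚ.≤-reflexive (trans (cong (M * q *_) r≡0) (ℚₚ.*-zeroʳ (M * q))))
    where
    r≡0 : r ≡ 0ℚ
    r≡0 = cube-ratio {q} {r} (x∙y⁻¹≈ε⇒x≈y ℚₚ.+-0-group _ _ d≡0)
  ... | no  d≢0 = inj₂ (subst (0ℚ <_) (sym (discriminant M q r)) (pos*pos (pos*pos M>0 M>0) (square-pos d≢0)))
    where
    discriminant : ∀ M q r →
      (M * (q * q * q) + M * M * (r * r * r)) * (M * (q * q * q) + M * M * (r * r * r))
        - ℕtoℚ 4 * ((M * q * r) * (M * q * r) * (M * q * r))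
      ≡ M * M * ((q * q * q - M * (r * r * r)) * (q * q * q - M * (r * r * r)))
    discriminant = solve-∀ ℚ-ring

  -- PosK m ξ does not determine ξ (normK unfolds into rational arithmetic), so
  -- positivity is wrapped in a record to let the element be inferred.
  record Pos (ξ : K) : Set where
    constructor pos
    field norm>0 : PosK m ξ
  open Pos public

  +K-ℚtoK-pos : Pos ξ → 0ℚ ≤ c → Pos (ξ +K ℚtoK c)
  +K-ℚtoK-pos {⟨ p , q , r ⟩} {c} (pos ξ>0) c≥0 = pos (subst (0ℚ <_) (sym (normK-+K-ℚtoK p q r c))
    (cubic-mono {x = p} {y = p + c} (single-real-root q r) (subst (0ℚ ≤_) (sym (p+c-p p c)) c≥0)
                (subst (0ℚ <_) (normK-as-cubic p q r) ξ>0)))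
    where
    p+c-p : ∀ p c → p + c - p ≡ c
    p+c-p = solve-∀ ℚ-ring

  mulK-pos : Pos ξ → Pos η → Pos (mulK m ξ η)
  mulK-pos {ξ} {η} (pos ξ>0) (pos η>0) = pos (subst (0ℚ <_) (sym (normK-mulK ξ η)) (pos*pos ξ>0 η>0))

  shK-pos : Pos ξ → Pos (shK m ξ)
  shK-pos {ξ} (pos ξ>0) = pos (subst (0ℚ <_) (sym (normK-shK ξ)) (pos*pos ξ>0 ξ>0))

  -- (ξ + η) Sh η = ξ Sh η + N η reduces the sum to a rational shift.
  +K-pos : Pos ξ → Pos η → Pos (ξ +K η)
  +K-pos {ξ} {η} ξ>0 η>0 =
    pos (pos*-cancelʳ (subst (0ℚ <_) (normK-mulK (ξ +K η) (shK m η)) (norm>0 [ξ+η]Shη>0)) (norm>0 (shK-pos η>0)))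
    where
    [ξ+η]Shη>0 : Pos (mulK m (ξ +K η) (shK m η))
    [ξ+η]Shη>0 = subst Pos (sym (mulK-+K-shK ξ η))
      (+K-ℚtoK-pos (mulK-pos ξ>0 (shK-pos η>0)) (ℚₚ.<⇒≤ (norm>0 η>0)))

  ·K-pos : 0ℚ < c → Pos ξ → Pos (c ·K ξ)
  ·K-pos {c} {ξ} c>0 (pos ξ>0) =
    pos (subst (0ℚ <_) (sym (normK-·K c ξ)) (pos*pos (pos*pos (pos*pos c>0 c>0) c>0) ξ>0))

  ·K-pos-cancel : 0ℚ < c → Pos (c ·K ξ) → Pos ξ
  ·K-pos-cancel {c} {ξ} c>0 (pos cξ>0) = pos (pos*-cancelʳ
    (subst (0ℚ <_) (trans (normK-·K c ξ) (ℚₚ.*-comm (c * c * c) (normK m ξ))) cξ>0)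
    (pos*pos (pos*pos c>0 c>0) c>0))

  +K-nonNeg·K-pos : Pos ξ → 0ℚ ≤ c → Pos η → Pos (ξ +K c ·K η)
  +K-nonNeg·K-pos {ξ} {c} {η} ξ>0 c≥0 η>0 with 0ℚ <? c
  ... | yes c>0 = +K-pos ξ>0 (·K-pos c>0 η>0)
  ... | no  c≯0 = subst (λ c → Pos (ξ +K c ·K η)) (ℚₚ.≤-antisym c≥0 (ℚₚ.≮⇒≥ c≯0))
                    (pos (subst (0ℚ <_) (sym (normK-+K-0·K ξ η)) (norm>0 ξ>0)))

  oneK-pos : Pos oneK
  oneK-pos = pos (subst (0ℚ <_) (sym normK-oneK) (ℚₚ.positive⁻¹ 1ℚ))

  αK-pos : Pos αK
  αK-pos = pos (subst (0ℚ <_) (sym normK-αK) M>0)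

  α²K-pos : Pos α²K
  α²K-pos = pos (subst (0ℚ <_) (sym normK-α²K) (pos*pos M>0 M>0))

  InBox : ℚ → K → Set
  InBox L β = PosK m (ℚtoK L -K β) × PosK m (β -K (-K ℚtoK L)) × PosK m (ℚtoK (L * L) -K shK m β)

  module _ (L : ℚ) (β : K) (box : InBox L β) where
    private
      L-β>0 : Pos (ℚtoK L -K β)
      L-β>0 = pos (proj₁ box)

      β+L>0 : Pos (β -K (-K ℚtoK L))
      β+L>0 = pos (proj₁ (proj₂ box))

      L²-Shβ>0 : Pos (ℚtoK (L * L) -K shK m β)
      L²-Shβ>0 = pos (proj₂ (proj₂ box))

      gap>0 : Pos (gap L β)
      gap>0 = ·K-pos-cancel three>0 (subst Pos (gap-identity L β)
        (+K-pos (mulK-pos L-β>0 β+L>0) (·K-pos two>0 L²-Shβ>0)))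

      Mr²≥0 : 0ℚ ≤ M * (c₂ β * c₂ β)
      Mr²≥0 = nonNeg*nonNeg (ℚₚ.<⇒≤ M>0) (square-nonNeg (c₂ β))

    c₀-bound : 0ℚ < L * L - c₀ β * c₀ β
    c₀-bound = cube-pos⇒pos (subst (0ℚ <_) (normK-gap₀ L (c₀ β) (c₁ β) (c₂ β))
      (norm>0 (+K-nonNeg·K-pos (+K-nonNeg·K-pos gap>0 (square-nonNeg (c₁ β)) α²K-pos) Mr²≥0 αK-pos)))

    c₁-bound : 0ℚ < (L * L * L) * (L * L * L) - (M * (c₁ β * c₁ β * c₁ β)) * (M * (c₁ β * c₁ β * c₁ β))
    c₁-bound = subst (0ℚ <_) (normK-gap₁ L (c₀ β) (c₁ β) (c₂ β))
      (norm>0 (+K-nonNeg·K-pos (+K-nonNeg·K-pos gap>0 (square-nonNeg (c₀ β)) oneK-pos) Mr²≥0 αK-pos))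

    c₂-bound : 0ℚ < (L * L * L) * (L * L * L) - (M * M * (c₂ β * c₂ β * c₂ β)) * (M * M * (c₂ β * c₂ β * c₂ β))
    c₂-bound = subst (0ℚ <_) (normK-gap₂ L (c₀ β) (c₁ β) (c₂ β))
      (norm>0 (+K-nonNeg·K-pos (+K-nonNeg·K-pos gap>0 (square-nonNeg (c₀ β)) oneK-pos) (square-nonNeg (c₁ β)) α²K-pos))

-- h k² is not a rational cube

prime-factor : ∀ {n} → 1 ℕ.< n → Σ[ p ∈ ℕ ] Prime p × p ∣ n
prime-factor {n@(suc _)} 1<n with factorise n
... | record { factors = [] ; isFactorisation = n≡1 } = ⊥-elim (ℕₚ.<-irrefl (sym n≡1) 1<n)
... | record { factors = p ∷ ps ; isFactorisation = n≡p*ps ; factorsPrime = p-prime ∷ _ } =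
  p , p-prime , divides (product ps) (trans n≡p*ps (ℕₚ.*-comm p (product ps)))

prime∣square⇒prime∣ : ∀ {p n} → Prime p → p ∣ n ℕ.* n → p ∣ n
prime∣square⇒prime∣ {p} {n} p-prime p∣n² = [ id , id ]′ (euclidsLemma n n p-prime p∣n²)

prime∣cube⇒prime∣ : ∀ {p n} → Prime p → p ∣ n ℕ.* n ℕ.* n → p ∣ n
prime∣cube⇒prime∣ {p} {n} p-prime p∣n³ =
  [ prime∣square⇒prime∣ p-prime , id ]′ (euclidsLemma (n ℕ.* n) n p-prime p∣n³)

-- The ℓ-adic valuation of n³ is divisible by 3, that of h k² d³ is 1.
cube≢squarefree-part : ∀ {ℓ h k n d} → Prime ℓ → ℓ ∣ h → ¬ ℓ ℕ.* ℓ ∣ h → Coprime h k → Coprime n d →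
                       n ℕ.* n ℕ.* n ≢ h ℕ.* (k ℕ.* k) ℕ.* (d ℕ.* d ℕ.* d)
cube≢squarefree-part {ℓ} {h} {k} {n} {d} ℓ-prime ℓ∣h@(divides h₁ h≡h₁ℓ) ℓ²∤h h⊥k n⊥d n³≡hk²d³ =
  ℓ²∤h (subst (ℓ ℕ.* ℓ ∣_) (sym h≡h₁ℓ) (*-monoˡ-∣ ℓ ℓ∣h₁))
  where
  instance
    ℓ-nonZero : ℕ.NonZero ℓ
    ℓ-nonZero = prime⇒nonZero ℓ-prime

  ℓ≢1 : ℓ ≢ 1
  ℓ≢1 refl = ¬prime[1] ℓ-prime

  ℓ∣n : ℓ ∣ n
  ℓ∣n = prime∣cube⇒prime∣ ℓ-prime (subst (ℓ ∣_) (sym n³≡hk²d³) (∣m⇒∣m*n _ (∣m⇒∣m*n _ ℓ∣h)))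

  ℓ∤k : ¬ ℓ ∣ k
  ℓ∤k ℓ∣k = ℓ≢1 (h⊥k (ℓ∣h , ℓ∣k))

  ℓ∤d : ¬ ℓ ∣ d
  ℓ∤d ℓ∣d = ℓ≢1 (n⊥d (ℓ∣n , ℓ∣d))

  regroup : ∀ ℓ h₁ k d → h₁ ℕ.* ℓ ℕ.* (k ℕ.* k) ℕ.* (d ℕ.* d ℕ.* d) ≡ ℓ ℕ.* (h₁ ℕ.* (k ℕ.* k) ℕ.* (d ℕ.* d ℕ.* d))
  regroup = ℕ-Solver.solve-∀

  ℓ³∣ℓh₁k²d³ : ℓ ℕ.* (ℓ ℕ.* ℓ) ∣ ℓ ℕ.* (h₁ ℕ.* (k ℕ.* k) ℕ.* (d ℕ.* d ℕ.* d))
  ℓ³∣ℓh₁k²d³ = subst₂ _∣_ (ℕₚ.*-assoc ℓ ℓ ℓ)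
    (trans n³≡hk²d³ (trans (cong (λ h → h ℕ.* (k ℕ.* k) ℕ.* (d ℕ.* d ℕ.* d)) h≡h₁ℓ) (regroup ℓ h₁ k d)))
    (*-pres-∣ (*-pres-∣ ℓ∣n ℓ∣n) ℓ∣n)

  ℓ∣h₁k²d³ : ℓ ∣ h₁ ℕ.* (k ℕ.* k) ℕ.* (d ℕ.* d ℕ.* d)
  ℓ∣h₁k²d³ = m*n∣⇒m∣ ℓ ℓ (*-cancelˡ-∣ ℓ ℓ³∣ℓh₁k²d³)

  ℓ∣h₁ : ℓ ∣ h₁
  ℓ∣h₁ with euclidsLemma (h₁ ℕ.* (k ℕ.* k)) (d ℕ.* d ℕ.* d) ℓ-prime ℓ∣h₁k²d³
  ... | inj₂ ℓ∣d³ = ⊥-elim (ℓ∤d (prime∣cube⇒prime∣ ℓ-prime ℓ∣d³))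
  ... | inj₁ ℓ∣h₁k² with euclidsLemma h₁ (k ℕ.* k) ℓ-prime ℓ∣h₁k²
  ...   | inj₁ ℓ∣h₁ = ℓ∣h₁
  ...   | inj₂ ℓ∣k² = ⊥-elim (ℓ∤k (prime∣square⇒prime∣ ℓ-prime ℓ∣k²))

cube-equation : ∀ t m → t * t * t ≡ ℕtoℚ m →
                let n = ℤ.∣ ℚ.↥ t ∣; d = ℚ.↧ₙ t in n ℕ.* n ℕ.* n ≡ m ℕ.* (d ℕ.* d ℕ.* d)
cube-equation t@(mkℚ n d-1 _) m t³≡m with t³≃m
  where
  t³≃m : (ℚ.toℚᵘ t ℚᵘ.* ℚ.toℚᵘ t) ℚᵘ.* ℚ.toℚᵘ t ℚᵘ.≃ ℚᵘ.mkℚᵘ (+ m) 0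
  t³≃m = ℚᵘₚ.≃-trans
    (ℚᵘₚ.≃-sym (ℚᵘₚ.≃-trans (ℚₚ.toℚᵘ-homo-* (t * t) t) (ℚᵘₚ.*-congʳ (ℚₚ.toℚᵘ-homo-* t t))))
    (ℚᵘₚ.≃-reflexive (cong ℚ.toℚᵘ (trans t³≡m (ℤtoℚ≡mkℚ (+ m)))))
... | ℚᵘ.*≡* n³≡md³ = begin
  ℤ.∣ n ∣ ℕ.* ℤ.∣ n ∣ ℕ.* ℤ.∣ n ∣                   ≡⟨ sym (trans (ℤₚ.abs-* (n ℤ.* n) n) (cong (ℕ._* ℤ.∣ n ∣) (ℤₚ.abs-* n n))) ⟩
  ℤ.∣ n ℤ.* n ℤ.* n ∣                               ≡⟨ cong ℤ.∣_∣ (sym (ℤₚ.*-identityʳ (n ℤ.* n ℤ.* n))) ⟩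
  ℤ.∣ n ℤ.* n ℤ.* n ℤ.* + 1 ∣                       ≡⟨ cong ℤ.∣_∣ n³≡md³ ⟩
  ℤ.∣ + m ℤ.* + (suc d-1 ℕ.* suc d-1 ℕ.* suc d-1) ∣ ≡⟨ ℤₚ.abs-* (+ m) _ ⟩
  m ℕ.* (suc d-1 ℕ.* suc d-1 ℕ.* suc d-1)           ∎
  where open ≡-Reasoning

hk²-not-cube : ∀ {h k} → 0 ℕ.< k → k ℕ.< h → Coprime h k → SquareFree h → ∀ t → t * t * t ≢ ℕtoℚ (h ℕ.* (k ℕ.* k))
hk²-not-cube {h} {k} 0<k k<h h⊥k h-squarefree t@(mkℚ _ _ n⊥d) t³≡m with prime-factor (ℕₚ.≤-<-trans 0<k k<h)
... | ℓ , ℓ-prime , ℓ∣h = cube≢squarefree-part ℓ-prime ℓ∣h (h-squarefree ℓ ℓ-prime) h⊥k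
                            (Coprimality.recompute n⊥d) (cube-equation t (h ℕ.* (k ℕ.* k)) t³≡m)

σOf≡1⊎3 : ∀ n → σOf n ≡ 1 ⊎ σOf n ≡ 3
σOf≡1⊎3 n with n ℕ.% 9
... | 0 = inj₁ refl
... | 1 = inj₂ refl
... | 2 = inj₁ refl
... | 3 = inj₁ refl
... | 4 = inj₁ refl
... | 5 = inj₁ refl
... | 6 = inj₁ refl
... | 7 = inj₁ refl
... | 8 = inj₂ refl
... | suc (suc (suc (suc (suc (suc (suc (suc (suc _)))))))) = inj₁ refl

recip-σOf : ∀ n → recip (σOf n) * ℕtoℚ (σOf n) ≡ 1ℚ
recip-σOf n with σOf n | σOf≡1⊎3 n
... | _ | inj₁ refl = refl
... | _ | inj₂ refl = refl

module Lattice (h k : ℕ) where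
  open Field h k

  lattice-point : Form → ℤ → ℤ → ℤ → K
  lattice-point F u v w = (ℤtoℚ u ·K g₁ F +K ℤtoℚ v ·K g₂ F) +K ℤtoℚ w ·K g₃ F

  module _ (a b c d e f : ℕ) where
    private
      F : Form
      F = form a b c d e f

    c₂-lattice-point : ∀ u v w → c₂ (lattice-point F u v w) ≡ ℤtoℚ w * ℕtoℚ f * c₂ θ
    c₂-lattice-point u v w = solve 12 (λ θ₀ θ₁ θ₂ u v w a b c d e f →
      π₂ (latticeE (θ₀ , θ₁ , θ₂) u v w a b c d e f) ⊜ w ⊗ f ⊗ θ₂) refl
      (c₀ θ) (c₁ θ) (c₂ θ) (ℤtoℚ u) (ℤtoℚ v) (ℤtoℚ w) (ℕtoℚ a) (ℕtoℚ b) (ℕtoℚ c) (ℕtoℚ d) (ℕtoℚ e) (ℕtoℚ f)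

    c₁-lattice-point : ∀ u v → c₁ (lattice-point F u v (+ 0)) ≡ ℤtoℚ v * ℕtoℚ c
    c₁-lattice-point u v = solve 11 (λ θ₀ θ₁ θ₂ u v a b c d e f →
      π₁ (latticeE (θ₀ , θ₁ , θ₂) u v (Κ 0ℚ) a b c d e f) ⊜ v ⊗ c) refl
      (c₀ θ) (c₁ θ) (c₂ θ) (ℤtoℚ u) (ℤtoℚ v) (ℕtoℚ a) (ℕtoℚ b) (ℕtoℚ c) (ℕtoℚ d) (ℕtoℚ e) (ℕtoℚ f)

    c₀-lattice-point : ∀ u → c₀ (lattice-point F u (+ 0) (+ 0)) ≡ ℕtoℚ a * ℤtoℚ u
    c₀-lattice-point u = solve 10 (λ θ₀ θ₁ θ₂ u a b c d e f →
      π₀ (latticeE (θ₀ , θ₁ , θ₂) u (Κ 0ℚ) (Κ 0ℚ) a b c d e f) ⊜ a ⊗ u) refl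
      (c₀ θ) (c₁ θ) (c₂ θ) (ℤtoℚ u) (ℕtoℚ a) (ℕtoℚ b) (ℕtoℚ c) (ℕtoℚ d) (ℕtoℚ e) (ℕtoℚ f)

    lattice-origin : lattice-point F (+ 0) (+ 0) (+ 0) ≡ 0K
    lattice-origin = K-≡
      (solve 9 (λ θ₀ θ₁ θ₂ a b c d e f → π₀ (latticeE (θ₀ , θ₁ , θ₂) o o o a b c d e f) ⊜ o) refl
        (c₀ θ) (c₁ θ) (c₂ θ) (ℕtoℚ a) (ℕtoℚ b) (ℕtoℚ c) (ℕtoℚ d) (ℕtoℚ e) (ℕtoℚ f))
      (solve 9 (λ θ₀ θ₁ θ₂ a b c d e f → π₁ (latticeE (θ₀ , θ₁ , θ₂) o o o a b c d e f) ⊜ o) refl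
        (c₀ θ) (c₁ θ) (c₂ θ) (ℕtoℚ a) (ℕtoℚ b) (ℕtoℚ c) (ℕtoℚ d) (ℕtoℚ e) (ℕtoℚ f))
      (solve 9 (λ θ₀ θ₁ θ₂ a b c d e f → π₂ (latticeE (θ₀ , θ₁ , θ₂) o o o a b c d e f) ⊜ o) refl
        (c₀ θ) (c₁ θ) (c₂ θ) (ℕtoℚ a) (ℕtoℚ b) (ℕtoℚ c) (ℕtoℚ d) (ℕtoℚ e) (ℕtoℚ f))
      where
      o : ∀ {n} → Expr ℚ n
      o = Κ 0ℚ

-- The coefficients of a short lattice point vanish

module Reduction {h k : ℕ} (m-not-cube : ∀ t → t * t * t ≢ ℕtoℚ (mOf h k)) where
  open Field h k
  open Lattice h k
  open NormIdentities m using (M; normK-αK-ℚtoK; normK-rα²-ℚtoK)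
  open PositiveCone m m-not-cube

  module _ (a b c d e f : ℕ) (0<c : 0 ℕ.< c) (0<f : 0 ℕ.< f)
           (L≤α : ℚtoK (ℕtoℚ a) ≤[ m ] α) (σL≤α̂ : ℚtoK (ℕtoℚ (σ ℕ.* a)) ≤[ m ] α̂) where
    private
      L : ℚ
      L = ℕtoℚ a

      F : Form
      F = form a b c d e f

      w≢0⇒¬c₂-bound : ∀ u v w → w ≢ + 0 → let r = c₂ (lattice-point F u v w) in
        ¬ 0ℚ < (L * L * L) * (L * L * L) - (M * M * (r * r * r)) * (M * M * (r * r * r))
      w≢0⇒¬c₂-bound u v w w≢0 bound =
        ¬scaled-square<square X (L * L * L) (W * W * W) (cube-nonNeg (ℕtoℚ-nonNeg a)) X-L³≥0
          (cube-square≥1 W (*-square≥1 (ℤtoℚ w) (ℕtoℚ f) (ℤtoℚ-square≥1 w≢0) (ℕtoℚ-square≥1 0<f)))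
          (subst (λ P → 0ℚ < (L * L * L) * (L * L * L) - P * P) P≡X*W³ bound)
        where
        s S W X : ℚ
        s = recip σ
        S = ℕtoℚ (σ ℕ.* a)
        W = ℤtoℚ w * ℕtoℚ f
        X = M * M * (c₂ θ * c₂ θ * c₂ θ)

        P≡X*W³ : let r = c₂ (lattice-point F u v w) in M * M * (r * r * r) ≡ X * (W * W * W)
        P≡X*W³ = trans (cong (λ r → M * M * (r * r * r)) (c₂-lattice-point a b c d e f u v w)) (regroup M W (c₂ θ))
          where
          regroup : ∀ M W t → M * M * (W * t * (W * t) * (W * t)) ≡ M * M * (t * t * t) * (W * W * W)
          regroup = solve-∀ ℚ-ring

        L≡sS : L ≡ s * S
        L≡sS = begin
          L                ≡⟨ sym (ℚₚ.*-identityˡ L) ⟩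
          1ℚ * L           ≡⟨ cong (_* L) (sym (recip-σOf m)) ⟩
          s * ℕtoℚ σ * L   ≡⟨ ℚₚ.*-assoc s (ℕtoℚ σ) L ⟩
          s * (ℕtoℚ σ * L) ≡⟨ cong (s *_) (sym (ℕtoℚ-* σ a)) ⟩
          s * S            ∎
          where open ≡-Reasoning

        X-L³≥0 : 0ℚ ≤ X - L * L * L
        X-L³≥0 = subst (λ L → 0ℚ ≤ X - L * L * L) (sym L≡sS) (subst (0ℚ ≤_) (sym (identity M s (recip k) S))
          (nonNeg*nonNeg (cube-nonNeg (recip-nonNeg σ)) (subst (0ℚ ≤_) (normK-rα²-ℚtoK (recip k) S) σL≤α̂)))
          where
          identity : ∀ M s r S → M * M * (s * (0ℚ + r) * (s * (0ℚ + r)) * (s * (0ℚ + r))) - s * S * (s * S) * (s * S)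
                                 ≡ s * s * s * (M * M * (r * r * r) - S * S * S)
          identity = solve-∀ ℚ-ring

      v≢0⇒¬c₁-bound : ∀ u v → v ≢ + 0 → let q = c₁ (lattice-point F u v (+ 0)) in
        ¬ 0ℚ < (L * L * L) * (L * L * L) - (M * (q * q * q)) * (M * (q * q * q))
      v≢0⇒¬c₁-bound u v v≢0 bound =
        ¬scaled-square<square M (L * L * L) (V * V * V) (cube-nonNeg (ℕtoℚ-nonNeg a)) (subst (0ℚ ≤_) (normK-αK-ℚtoK L) L≤α)
          (cube-square≥1 V (*-square≥1 (ℤtoℚ v) (ℕtoℚ c) (ℤtoℚ-square≥1 v≢0) (ℕtoℚ-square≥1 0<c)))
          (subst (λ q → 0ℚ < (L * L * L) * (L * L * L) - (M * (q * q * q)) * (M * (q * q * q)))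
                 (c₁-lattice-point a b c d e f u v) bound)
        where
        V : ℚ
        V = ℤtoℚ v * ℕtoℚ c

      u≢0⇒¬c₀-bound : ∀ u → u ≢ + 0 → let p = c₀ (lattice-point F u (+ 0) (+ 0)) in ¬ 0ℚ < L * L - p * p
      u≢0⇒¬c₀-bound u u≢0 bound =
        ¬scaled-square<square L L (ℤtoℚ u) (ℕtoℚ-nonNeg a) (ℚₚ.≤-reflexive (sym (ℚₚ.+-inverseʳ L))) (ℤtoℚ-square≥1 u≢0)
          (subst (λ p → 0ℚ < L * L - p * p) (c₀-lattice-point a b c d e f u) bound)

    bounded-lattice-point≡0 : ∀ u v w → InBox L (lattice-point F u v w) → lattice-point F u v w ≡ 0K
    bounded-lattice-point≡0 u v w box = begin
      lattice-point F u v w               ≡⟨ cong₂ (lattice-point F u) v≡0 w≡0 ⟩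
      lattice-point F u (+ 0) (+ 0)       ≡⟨ cong (λ u → lattice-point F u (+ 0) (+ 0)) u≡0 ⟩
      lattice-point F (+ 0) (+ 0) (+ 0)   ≡⟨ lattice-origin a b c d e f ⟩
      0K                                  ∎
      where
      open ≡-Reasoning

      w≡0 : w ≡ + 0
      w≡0 = decidable-stable (w ℤ.≟ + 0) λ w≢0 → w≢0⇒¬c₂-bound u v w w≢0 (c₂-bound L (lattice-point F u v w) box)

      box′ : InBox L (lattice-point F u v (+ 0))
      box′ = subst (λ w → InBox L (lattice-point F u v w)) w≡0 box

      v≡0 : v ≡ + 0
      v≡0 = decidable-stable (v ℤ.≟ + 0) λ v≢0 → v≢0⇒¬c₁-bound u v v≢0 (c₁-bound L (lattice-point F u v (+ 0)) box′)

      box″ : InBox L (lattice-point F u (+ 0) (+ 0))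
      box″ = subst (λ v → InBox L (lattice-point F u v (+ 0))) v≡0 box′

      u≡0 : u ≡ + 0
      u≡0 = decidable-stable (u ℤ.≟ + 0) λ u≢0 → u≢0⇒¬c₀-bound u u≢0 (c₀-bound L (lattice-point F u (+ 0) (+ 0)) box″)

mainTheorem4 : (h k : ℕ) → 0 ℕ.< k → k ℕ.< h → Coprime h k → SquareFree h → SquareFree k →
    let open Field h k in
    (F : Form) → IsCanonicalIdeal F → Primitive F →
    ℚtoK (ℕtoℚ (Len F)) ≤[ m ] α →
    ℚtoK (ℕtoℚ (σ ℕ.* Len F)) ≤[ m ] α̂ →
    Reduced F
mainTheorem4 h k 0<k k<h h⊥k h-squarefree _ (Field.form a b c d e f) ((_ , 0<c , 0<f , _) , _) _ L≤α σL≤α̂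
             β (u , v , w , β≡uvw) (-L<β , β<L) (_ , Shβ<L²) =
  trans β≡uvw (bounded-lattice-point≡0 a b c d e f 0<c 0<f L≤α σL≤α̂ u v w (subst (InBox (ℕtoℚ a)) β≡uvw box))
  where
  m-not-cube : ∀ t → t * t * t ≢ ℕtoℚ (mOf h k)
  m-not-cube = hk²-not-cube 0<k k<h h⊥k h-squarefree

  open Lattice h k using (lattice-point)
  open PositiveCone (mOf h k) m-not-cube using (InBox)
  open Reduction {h} {k} m-not-cube

  box : InBox (ℕtoℚ a) β
  box = β<L , -L<β , subst (λ L² → PosK (mOf h k) (ℚtoK L² -K shK (mOf h k) β)) (ℕtoℚ-* a a) Shβ<L²
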